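{- Let $n$ be a positive integer. Let $\Delta_n^0=\{\gamma\in B_n:\gamma_n>0,\ \operatorname{fmaj}(\gamma)\text{ even}\}$ and $D_n^0=\{\gamma\in D_n:\operatorname{Dmaj}(\gamma)\text{ even}\}$. Then \[\sum_{\gamma \in \Delta_n^0}(-1)^{\ell_B(\gamma)}q^{\operatorname{fmaj}(\gamma)}=\sum_{\gamma \in D_n^0}(-1)^{\ell_D(\gamma)}q^{\operatorname{Dmaj}(\gamma)}.\]
   Context: $B_n$ is the group of bijections $\beta$ of $[-n,n]\setminus\{0\}$ with $\beta(-i)=-\beta(i)$, written in window notation $\beta=[\beta_1,\dots,\beta_n]$ with $\beta_i=\beta(i)$. For $\beta\in B_n$: $\operatorname{inv}(\beta)=|\{(i,j): 1\le i<j\le n,\ \beta_i>\beta_j\}|$ (usual order on integers); $\operatorname{N}_1(\beta)=|\{i:\beta_i<0\}|$; $\operatorname{N}_2(\beta)=|\{\{i,j\}: i\neq j,\ \beta_i+\beta_j<0\}|$; $\ell_B(\beta)=\operatorname{inv}(\beta)+\operatorname{N}_1(\beta)+\operatorname{N}_2(\beta)$. The descent set $\operatorname{Des}(\beta)$ is the set of $i\in[n-1]$ with $\beta_i\succ\beta_{i+1}$, where $\prec$ is the total order $-1\prec-2\prec\cdots\prec-n\prec 1\prec 2\prec\cdots\prec n$; $\operatorname{maj}(\beta)=\sum_{i\in\operatorname{Des}(\beta)}i$ and $\operatorname{fmaj}(\beta)=2\operatorname{maj}(\beta)+\operatorname{N}_1(\beta)$. $D_n=\{\gamma\in B_n:\operatorname{N}_1(\gamma)\text{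 even}\}$ with length $\ell_D(\gamma)=\operatorname{inv}(\gamma)+\operatorname{N}_2(\gamma)$. For $\gamma\in D_n$, $|\gamma|_n=[\gamma_1,\dots,\gamma_{n-1},|\gamma_n|]$ and $\operatorname{Dmaj}(\gamma)=\operatorname{fmaj}(|\gamma|_n)$. -}

module Defs where

open import Data.Nat as ℕ using (ℕ; zero; suc)
open import Data.Integer as ℤ using (ℤ; +_; -[1+_]; ∣_∣; -1ℤ; 0ℤ)
open import Data.Bool using (Bool; true; false; if_then_else_; _∧_; not)
open import Data.List using (List; []; _∷_; map; concatMap; filter; sum; length; foldr; _++_; applyUpTo; upTo; zip; reverse)
open import Data.Product using (_×_; _,_)
open import Relation.Nullary.Decidable using (⌊_⌋)
open import Relation.Unary using (Pred; Decidable)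
open import Data.Bool using (T; T?)

-- Elements of B_n are represented by their window [β₁,…,βₙ] as a list of integers.

entries : ℕ → List ℤ
entries n = map (λ i → ℤ.- (+ suc i)) (upTo n) ++ map (λ i → + suc i) (upTo n)

words : ℕ → ℕ → List (List ℤ)
words n zero = [] ∷ []
words n (suc k) = concatMap (λ x → map (x ∷_) (words n k)) (entries n)

distinctAbs : List ℤ → Bool
distinctAbs [] = true
distinctAbs (x ∷ xs) = foldr (λ y b → not ⌊ ∣ x ∣ ℕ.≟ ∣ y ∣ ⌋ ∧ b) true xs ∧ distinctAbs xs

-- B_n: windows of length n, letters in [-n,n]\{0}, with distinct absolute
-- values (equivalently, signed permutations of [n]), listed without repetition
Bn : ℕ → List (List ℤ)
Bn n = filter (λ w → T? (distinctAbs w)) (words n n)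

count : {A : Set} → (A → Bool) → List A → ℕ
count p [] = 0
count p (x ∷ xs) = (if p x then 1 else 0) ℕ.+ count p xs

_<ᵇ_ : ℤ → ℤ → Bool
x <ᵇ y = ⌊ x ℤ.<? y ⌋

inv : List ℤ → ℕ
inv [] = 0
inv (x ∷ xs) = count (λ y → y <ᵇ x) xs ℕ.+ inv xs

N₁ : List ℤ → ℕ
N₁ = count (λ x → x <ᵇ 0ℤ)

N₂ : List ℤ → ℕ
N₂ [] = 0
N₂ (x ∷ xs) = count (λ y → (x ℤ.+ y) <ᵇ 0ℤ) xs ℕ.+ N₂ xs

ℓB : List ℤ → ℕ
ℓB w = inv w ℕ.+ N₁ w ℕ.+ N₂ w

ℓD : List ℤ → ℕ
ℓD w = inv w ℕ.+ N₂ w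

-- the total order -1 ≺ -2 ≺ ⋯ ≺ -n ≺ 1 ≺ ⋯ ≺ n, via a rank in ℕ
-- (negative x ↦ |x|, positive x ↦ n + x)
rank : ℕ → ℤ → ℕ
rank n x = if x <ᵇ 0ℤ then ∣ x ∣ else n ℕ.+ ∣ x ∣

_≻[_]_ : ℤ → ℕ → ℤ → Bool
x ≻[ n ] y = ⌊ rank n y ℕ.<? rank n x ⌋

-- sum of positions i (1-based, starting at position p) with wᵢ ≻ wᵢ₊₁
majFrom : ℕ → ℕ → List ℤ → ℕ
majFrom n p [] = 0
majFrom n p (x ∷ []) = 0
majFrom n p (x ∷ y ∷ ys) = (if x ≻[ n ] y then p else 0) ℕ.+ majFrom n (suc p) (y ∷ ys)

maj : ℕ → List ℤ → ℕ
maj n = majFrom n 1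

fmaj : ℕ → List ℤ → ℕ
fmaj n w = 2 ℕ.* maj n w ℕ.+ N₁ w

isEven : ℕ → Bool
isEven zero = true
isEven (suc zero) = false
isEven (suc (suc k)) = isEven k

-- |γ|_n : replace the last letter by its absolute value
absLast : List ℤ → List ℤ
absLast [] = []
absLast (x ∷ []) = + ∣ x ∣ ∷ []
absLast (x ∷ y ∷ ys) = x ∷ absLast (y ∷ ys)

Dmaj : ℕ → List ℤ → ℕ
Dmaj n w = fmaj n (absLast w)

lastPos : List ℤ → Bool
lastPos [] = false
lastPos (x ∷ []) = 0ℤ <ᵇ x
lastPos (x ∷ y ∷ ys) = lastPos (y ∷ ys)

Δ⁰ : ℕ → List (List ℤ)
Δ⁰ n = filter (λ w → T? (lastPos w ∧ isEven (fmaj n w))) (Bn n)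

D⁰ : ℕ → List (List ℤ)
D⁰ n = filter (λ w → T? (isEven (N₁ w) ∧ isEven (Dmaj n w))) (Bn n)

signedSum : ℤ → (List ℤ → ℕ) → (List ℤ → ℕ) → List (List ℤ) → ℤ
signedSum q ℓ stat ws = foldr (λ w acc → (-1ℤ ℤ.^ ℓ w) ℤ.* (q ℤ.^ stat w) ℤ.+ acc) 0ℤ ws

{-# OPTIONS --safe #-}
-- If γₙ > 0 then |γ|ₙ = γ, and since fmaj ≡ N₁ (mod 2), γ ∈ Δ⁰ₙ exactly when
-- N₁(γ) is even, i.e. γ ∈ Dₙ; then Dmaj(γ) = fmaj(γ) is even as well.  If γₙ < 0
-- then N₁(γ) = N₁(|γ|ₙ) + 1, so N₁(γ) and Dmaj(γ) have opposite parities and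
-- γ ∉ D⁰ₙ.  Hence Δ⁰ₙ = D⁰ₙ, and on this set fmaj = Dmaj and ℓ_B = N₁ + ℓ_D with
-- N₁ even, so the two sums agree term by term.
module Submission where

open import Defs
open import Data.Nat as ℕ using (ℕ; _≤_; zero; suc)
import Data.Nat.Properties as ℕ
open import Data.Integer as ℤ using (ℤ; +_; -[1+_]; -1ℤ; 0ℤ; NonZero)
import Data.Integer.Properties as ℤ
open import Data.Bool using (Bool; true; false; not; _∧_; T; T?; if_then_else_)
open import Data.Bool.Properties using (∧-idem; ∧-inverseˡ; T-∧)
open import Data.List using (List; []; _∷_; filter; upTo)
open import Data.List.Relation.Unary.All as All using (All; []; _∷_)
open import Data.List.Relation.Unary.All.Properties
  using (map⁺; ++⁺; concat⁺; filter⁺; all-filter)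
open import Data.Product using (proj₁; proj₂)
open import Data.Empty using (⊥)
open import Function using (Equivalence)
open import Relation.Binary.PropositionalEquality
open ≡-Reasoning

isEven-suc : ∀ k → isEven (suc k) ≡ not (isEven k)
isEven-suc zero = refl
isEven-suc (suc zero) = refl
isEven-suc (suc (suc k)) = isEven-suc k

isEven-2*+ : ∀ m k → isEven (2 ℕ.* m ℕ.+ k) ≡ isEven k
isEven-2*+ zero k = refl
isEven-2*+ (suc m) k =
  trans (cong (λ j → isEven (j ℕ.+ k)) (ℕ.*-suc 2 m)) (isEven-2*+ m k)

fmaj-parity : ∀ n w → isEven (fmaj n w) ≡ isEven (N₁ w)
fmaj-parity n w = isEven-2*+ (maj n w) (N₁ w)

-1^even+ : ∀ k m → T (isEven k) → -1ℤ ℤ.^ (k ℕ.+ m) ≡ -1ℤ ℤ.^ m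
-1^even+ zero m _ = refl
-1^even+ (suc (suc k)) m k-even = begin
  -1ℤ ℤ.* (-1ℤ ℤ.* -1ℤ ℤ.^ (k ℕ.+ m)) ≡⟨ ℤ.*-assoc -1ℤ -1ℤ _ ⟨
  -1ℤ ℤ.* -1ℤ ℤ.* -1ℤ ℤ.^ (k ℕ.+ m)   ≡⟨ ℤ.*-identityˡ _ ⟩
  -1ℤ ℤ.^ (k ℕ.+ m)                    ≡⟨ -1^even+ k m k-even ⟩
  -1ℤ ℤ.^ m                            ∎

ℓB≡N₁+ℓD : ∀ w → ℓB w ≡ N₁ w ℕ.+ ℓD w
ℓB≡N₁+ℓD w =
  trans (cong (ℕ._+ N₂ w) (ℕ.+-comm (inv w) (N₁ w))) (ℕ.+-assoc (N₁ w) (inv w) (N₂ w))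

-- What makes ¬ lastPos w mean γₙ < 0; it fails for the empty window, hence 1 ≤ n.
LastNonZero : List ℤ → Set
LastNonZero [] = ⊥
LastNonZero (x ∷ []) = NonZero x
LastNonZero (x ∷ y ∷ ys) = LastNonZero (y ∷ ys)

∷-lastNonZero : ∀ x w → LastNonZero w → LastNonZero (x ∷ w)
∷-lastNonZero x (y ∷ ys) nz = nz

entries-nonZero : ∀ n → All NonZero (entries n)
entries-nonZero n = ++⁺ (map⁺ (All.universal _ (upTo n))) (map⁺ (All.universal _ (upTo n)))

words-lastNonZero : ∀ n k → All LastNonZero (words n (suc k))
words-lastNonZero n zero =
  concat⁺ (map⁺ (All.map (λ nz → nz ∷ []) (entries-nonZero n)))
words-lastNonZero n (suc k) =
  concat⁺ (map⁺ (All.universal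
    (λ x → map⁺ (All.map (λ {w} → ∷-lastNonZero x w) (words-lastNonZero n k))) (entries n)))

absLast-lastPos : ∀ w → T (lastPos w) → absLast w ≡ w
absLast-lastPos (+ k ∷ []) _ = refl
absLast-lastPos (x ∷ y ∷ ys) pos = cong (x ∷_) (absLast-lastPos (y ∷ ys) pos)

N₁-absLast : ∀ w → LastNonZero w → T (not (lastPos w)) → N₁ w ≡ suc (N₁ (absLast w))
N₁-absLast (+ zero ∷ []) () _
N₁-absLast (+ suc k ∷ []) _ ()
N₁-absLast (-[1+ k ] ∷ []) _ _ = refl
N₁-absLast (x ∷ y ∷ ys) nz neg =
  trans (cong (negative ℕ.+_) (N₁-absLast (y ∷ ys) nz neg)) (ℕ.+-suc negative _)
  where negative = if x <ᵇ 0ℤ then 1 else 0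

lastPos-parity : ∀ w → LastNonZero w →
  lastPos w ∧ isEven (N₁ w) ≡ isEven (N₁ w) ∧ isEven (N₁ (absLast w))
lastPos-parity w nz with lastPos w | absLast-lastPos w | N₁-absLast w nz
... | true  | absLast≡w | _ rewrite absLast≡w _ = sym (∧-idem _)
... | false | _ | N₁≡suc rewrite N₁≡suc _ = sym (begin
  isEven (suc k) ∧ isEven k ≡⟨ cong (_∧ isEven k) (isEven-suc k) ⟩
  not (isEven k) ∧ isEven k ≡⟨ ∧-inverseˡ (isEven k) ⟩
  false                     ∎)
  where k = N₁ (absLast w)

Δ⁰-test≡D⁰-test : ∀ n w → LastNonZero w →
  lastPos w ∧ isEven (fmaj n w) ≡ isEven (N₁ w) ∧ isEven (Dmaj n w)
Δ⁰-test≡D⁰-test n w nz = begin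
  lastPos w ∧ isEven (fmaj n w)            ≡⟨ cong (lastPos w ∧_) (fmaj-parity n w) ⟩
  lastPos w ∧ isEven (N₁ w)                ≡⟨ lastPos-parity w nz ⟩
  isEven (N₁ w) ∧ isEven (N₁ (absLast w))  ≡⟨ cong (isEven (N₁ w) ∧_) (fmaj-parity n (absLast w)) ⟨
  isEven (N₁ w) ∧ isEven (Dmaj n w)        ∎

filter-cong-All : ∀ {A : Set} {P : A → Set} (p r : A → Bool) →
  (∀ x → P x → p x ≡ r x) → ∀ {xs} → All P xs →
  filter (λ x → T? (p x)) xs ≡ filter (λ x → T? (r x)) xs
filter-cong-All p r p≡r [] = refl
filter-cong-All p r p≡r {x ∷ xs} (px ∷ pxs) with p x | r x | p≡r x px
... | true  | .true  | refl = cong (x ∷_) (filter-cong-All p r p≡r pxs)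
... | false | .false | refl = filter-cong-All p r p≡r pxs

Δ⁰≡D⁰ : ∀ n → 1 ≤ n → Δ⁰ n ≡ D⁰ n
Δ⁰≡D⁰ (suc m) _ =
  filter-cong-All _ _ (Δ⁰-test≡D⁰-test (suc m))
    (filter⁺ (λ w → T? (distinctAbs w)) (words-lastNonZero (suc m) m))

signedTerm : ℤ → (List ℤ → ℕ) → (List ℤ → ℕ) → List ℤ → ℤ
signedTerm q ℓ stat w = (-1ℤ ℤ.^ ℓ w) ℤ.* (q ℤ.^ stat w)

signedSum-cong : ∀ q ℓ ℓ′ stat stat′ {ws} →
  All (λ w → signedTerm q ℓ stat w ≡ signedTerm q ℓ′ stat′ w) ws →
  signedSum q ℓ stat ws ≡ signedSum q ℓ′ stat′ ws
signedSum-cong q ℓ ℓ′ stat stat′ [] = refl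
signedSum-cong q ℓ ℓ′ stat stat′ (eq ∷ eqs) =
  cong₂ ℤ._+_ eq (signedSum-cong q ℓ ℓ′ stat stat′ eqs)

signedTerm-Δ⁰ : ∀ n q w → T (lastPos w ∧ isEven (fmaj n w)) →
  signedTerm q ℓB (fmaj n) w ≡ signedTerm q ℓD (Dmaj n) w
signedTerm-Δ⁰ n q w inΔ⁰ = cong₂ ℤ._*_ sign (cong (λ v → q ℤ.^ fmaj n v) (sym absLast≡w))
  where
  absLast≡w : absLast w ≡ w
  absLast≡w = absLast-lastPos w (proj₁ (Equivalence.to T-∧ inΔ⁰))

  N₁-even : T (isEven (N₁ w))
  N₁-even = subst T (fmaj-parity n w) (proj₂ (Equivalence.to T-∧ inΔ⁰))

  sign : -1ℤ ℤ.^ ℓB w ≡ -1ℤ ℤ.^ ℓD w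
  sign = trans (cong (-1ℤ ℤ.^_) (ℓB≡N₁+ℓD w)) (-1^even+ (N₁ w) (ℓD w) N₁-even)

lemma4p5 : (n : ℕ) → 1 ≤ n → (q : ℤ) →
    signedSum q ℓB (fmaj n) (Δ⁰ n) ≡ signedSum q ℓD (Dmaj n) (D⁰ n)
lemma4p5 n 1≤n q = begin
  signedSum q ℓB (fmaj n) (Δ⁰ n)  ≡⟨ signedSum-cong q ℓB ℓD (fmaj n) (Dmaj n)
                                       (All.map (λ {w} → signedTerm-Δ⁰ n q w) inΔ⁰) ⟩
  signedSum q ℓD (Dmaj n) (Δ⁰ n)  ≡⟨ cong (signedSum q ℓD (Dmaj n)) (Δ⁰≡D⁰ n 1≤n) ⟩
  signedSum q ℓD (Dmaj n) (D⁰ n)  ∎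
  where
  inΔ⁰ : All (λ w → T (lastPos w ∧ isEven (fmaj n w))) (Δ⁰ n)
  inΔ⁰ = all-filter (λ w → T? (lastPos w ∧ isEven (fmaj n w))) (Bn n)
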